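{- Let $m\geq 1$. Every class $\mathscr C$ of finite graphs that is $2$-covered by a class of embedded $m$-partite cographs is order-defined.
   Context: A plane tree is a rooted tree in which the children of each vertex are linearly ordered from left to right; $L(T)$ is its set of leaves, $I(T)$ its set of internal nodes, and $u\wedge v$ the least common ancestor of $u,v$. An embedded $m$-partite cograph is a graph $G$ obtained from a plane tree $T$, a coloring $\gamma_L\colon L(T)\to\{1,\dots,m\}$ and an assignment to each $v\in I(T)$ of a function $f_v\colon[m]\times[m]\to\{0,1\}$, as follows: $V(G)=L(T)$, and two distinct leaves $u,v$, where the branch from $u\wedge v$ to $u$ lies to the left of the branch from $u\wedge v$ to $v$, are adjacent iff $f_{u\wedge v}(\gamma_L(u),\gamma_L(v))=1$. A class $\mathscr C$ is $2$-covered by a class $\mathscr D$ if there is an integer $K\geq 2$ such that every $G\in\mathscr C$ has a vertex partition $V_1,\dots,V_K$ with $G[V_i\cup V_j]\in\mathscr D$ for all $1\leq i<j\leq K$. A class is order-defined if it is contained in ${\rm Age}(\mathbf U)$ (finite graphs isomorphic to finite induced subgraphs of $\mathbf U$) for some graph $\mathbf U$ with vertex set $\mathbb Q^k$ whose adjacency between distinct tuples $\bar a,\bar b$ is given by $\phi(\bar a,\bar b)\vee\phi(\bar b,\bar a)$ for a first-order formula $\phi$ without parameters in the language $\{<\}$, evaluated in $(\mathbb Q,<)$. -}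

module Defs where

open import Data.Nat using (ℕ; zero; suc; _+_)
open import Data.Fin using (Fin; _<_)
open import Data.Bool using (Bool; true; false)
open import Data.List using (List; []; _∷_)
open import Data.Vec using (Vec; _++_; lookup)
open import Data.Product using (Σ; ∃; _×_; _,_)
open import Data.Sum using (_⊎_)
open import Data.Empty using (⊥)
open import Data.Unit using (⊤)
open import Relation.Nullary using (¬_)
open import Relation.Binary.PropositionalEquality using (_≡_)
import Data.Rational as Q
open Q using (ℚ)

record FinGraph : Set where
  field
    size  : ℕ
    adj   : Fin size → Fin size → Bool
    sym   : ∀ x y → adj x y ≡ adj y x
    irrefl : ∀ x → adj x x ≡ false
open FinGraph public

Class : Set₁
Class = FinGraph → Set

record Iso (G : FinGraph) (V : Set) (a : V → V → Bool) : Set where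
  field
    to      : Fin (size G) → V
    from    : V → Fin (size G)
    from-to : ∀ x → from (to x) ≡ x
    to-from : ∀ v → to (from v) ≡ v
    pres    : ∀ x y → adj G x y ≡ a (to x) (to y)

-- Embedded m-partite cographs
-- A plane tree whose leaves carry a colour in Fin m and whose internal
-- nodes carry a function f_v : [m] × [m] → {0,1}; children are ordered
-- left to right by the list.

data Tree (m : ℕ) : Set where
  leaf : Fin m → Tree m
  node : (Fin m → Fin m → Bool) → List (Tree m) → Tree m

-- Leaves of a tree (= vertices of the associated graph), as paths
mutual
  data Leaf {m : ℕ} : Tree m → Set where
    here  : ∀ {c} → Leaf (leaf c)
    under : ∀ {f ts} → LeafL ts → Leaf (node f ts)

  data LeafL {m : ℕ} : List (Tree m) → Set where
    here  : ∀ {t ts} → Leaf t → LeafL (t ∷ ts)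
    there : ∀ {t ts} → LeafL ts → LeafL (t ∷ ts)

mutual
  colour : ∀ {m} {t : Tree m} → Leaf t → Fin m
  colour {t = leaf c} here = c
  colour (under p) = colourL p

  colourL : ∀ {m} {ts : List (Tree m)} → LeafL ts → Fin m
  colourL (here p)  = colour p
  colourL (there p) = colourL p

-- adjacency: for distinct leaves u (left branch) and v (right branch) at
-- their least common ancestor w, adjacent iff f_w (γ u) (γ v) = 1.
mutual
  cgAdj : ∀ {m} (t : Tree m) → Leaf t → Leaf t → Bool
  cgAdj (leaf c) here here = false
  cgAdj (node f ts) (under p) (under q) = cgAdjL f ts p q

  -- f is the function of the node whose children are (a suffix of) ts
  cgAdjL : ∀ {m} (f : Fin m → Fin m → Bool) (ts : List (Tree m)) →
           LeafL ts → LeafL ts → Bool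
  cgAdjL f (t ∷ ts) (here p)  (here q)  = cgAdj t p q
  cgAdjL f (t ∷ ts) (here p)  (there q) = f (colour p) (colourL q)
  cgAdjL f (t ∷ ts) (there p) (here q)  = f (colour q) (colourL p)
  cgAdjL f (t ∷ ts) (there p) (there q) = cgAdjL f ts p q

IsEmbCograph : ℕ → FinGraph → Set
IsEmbCograph m G = Σ (Tree m) λ t → Iso G (Leaf t) (cgAdj t)

InPair : (G : FinGraph) {K : ℕ} → (Fin (size G) → Fin K) → Fin K → Fin K → Set
InPair G part i j = Σ (Fin (size G)) λ x → (part x ≡ i) ⊎ (part x ≡ j)

pairAdj : (G : FinGraph) {K : ℕ} (part : Fin (size G) → Fin K) (i j : Fin K) →
          InPair G part i j → InPair G part i j → Bool
pairAdj G part i j (x , _) (y , _) = adj G x y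

TwoCovered : Class → Class → Set
TwoCovered C D =
  Σ ℕ λ K → (2 Data.Nat.≤ K) ×
    (∀ G → C G →
      Σ (Fin (size G) → Fin K) λ part →
        ∀ (i j : Fin K) → i < j →
          Σ FinGraph λ H → D H × Iso H (InPair G part i j) (pairAdj G part i j))

-- First-order formulas in the language {<} (with equality), de Bruijn
-- variables: Formula n has free variables among Fin n.

data Formula : ℕ → Set where
  _≐_ _≺_ : ∀ {n} → Fin n → Fin n → Formula n
  ⊤' ⊥'   : ∀ {n} → Formula n
  ¬'_     : ∀ {n} → Formula n → Formula n
  _∧'_ _∨'_ _⇒'_ : ∀ {n} → Formula n → Formula n → Formula n
  ∃' ∀'   : ∀ {n} → Formula (suc n) → Formula n

-- satisfaction in (ℚ, <); variable 0 is the innermost bound one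
Sat : ∀ {n} → Formula n → Vec ℚ n → Set
Sat (x ≐ y) ρ = lookup ρ x ≡ lookup ρ y
Sat (x ≺ y) ρ = lookup ρ x Q.< lookup ρ y
Sat ⊤' ρ = ⊤
Sat ⊥' ρ = ⊥
Sat (¬' φ) ρ = ¬ Sat φ ρ
Sat (φ ∧' ψ) ρ = Sat φ ρ × Sat ψ ρ
Sat (φ ∨' ψ) ρ = Sat φ ρ ⊎ Sat ψ ρ
Sat (φ ⇒' ψ) ρ = Sat φ ρ → Sat ψ ρ
Sat (∃' φ) ρ = Σ ℚ λ q → Sat φ (q Data.Vec.∷ ρ)
Sat (∀' φ) ρ = (q : ℚ) → Sat φ (q Data.Vec.∷ ρ)

UAdj : ∀ k → Formula (k + k) → Vec ℚ k → Vec ℚ k → Set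
UAdj k φ a b = Sat φ (a ++ b) ⊎ Sat φ (b ++ a)

InAge : ∀ {k} → Formula (k + k) → FinGraph → Set
InAge {k} φ G =
  Σ (Fin (size G) → Vec ℚ k) λ e →
    (∀ x y → e x ≡ e y → x ≡ y) ×
    (∀ x y → ¬ (x ≡ y) →
       (adj G x y ≡ true → UAdj k φ (e x) (e y)) ×
       (UAdj k φ (e x) (e y) → adj G x y ≡ true))

OrderDefined : Class → Set
OrderDefined C = Σ ℕ λ k → Σ (Formula (k + k)) λ φ → ∀ G → C G → InAge {k} φ G

module Submission where

-- Order the leaves of the plane
--    tree T from left to right (pos) and, for colours a, b, by the (a,b)-twisted
--    order in which the children of every node v with f_v(a,b) = 1 are reversed
--    (twist a b).  If u lies left of v, then u ~ v iff the (γ u, γ v)-twisted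
--    order inverts them (adjacency-is-inversion).
-- 2. Charts.  A chart of G is an injective, adjacency-preserving partial map into
--    the leaves of an embedded cograph.  If n charts cover every pair of vertices,
--    G embeds into U_φ for a formula φ depending only on n and m (ChartEmbedding):
--    a vertex becomes the tuple of natural numbers (its index, 1, and for each
--    chart its colour indicators, position and twisted positions), read in ℚ, and
--    φ(x̄, ȳ) states the inversion criterion of 1 inside some chart.
-- 3. A 2-covering with K ≥ 2 parts gives K² charts, one for each pair of parts
--    (TwoCoverCharts); the theorem follows.

open import Defs hiding (sym)
open import Data.Nat using (ℕ; zero; suc; _+_; _*_; _≤_; _<_; _<?_; s≤s; z≤n; z<s)
open import Data.Nat.Properties
  using (<-≤-trans; ≤-trans; <⇒≤; ≤⇒≯; <-irrefl; <-asym; m≤m+n; m≤n+m; +-comm;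
         +-monoˡ-<; +-monoʳ-<; +-cancelˡ-<; +-cancelˡ-≡; <-cmp)
open import Data.Fin using (Fin; zero; suc; toℕ; _↑ˡ_; _↑ʳ_; _≟_)
open import Data.Fin.Properties using (1↔⊤; +↔⊎; *↔×; toℕ-injective)
import Data.Fin as F
import Data.Fin.Properties as Fₚ
open import Data.Bool using (Bool; true; false; if_then_else_)
open import Data.List using (List; []; _∷_)
open import Data.Empty using (⊥-elim)
open import Data.Product using (Σ; _×_; _,_; proj₁; proj₂; uncurry)
open import Data.Sum using (_⊎_; inj₁; inj₂)
open import Data.Vec using (Vec; _++_; lookup; tabulate)
open import Data.Vec.Properties using (lookup-++ˡ; lookup-++ʳ; lookup∘tabulate)
open import Data.Unit using (⊤; tt)
import Data.Integer as ℤ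
import Data.Integer.Properties as ℤ
import Data.Nat.Coprimality as Coprime
import Data.Rational as ℚ
open ℚ using (ℚ; mkℚ)
open import Function using (_∘_)
open import Relation.Nullary using (¬_; does; Dec; yes; no)
open import Relation.Binary.Definitions using (tri<; tri≈; tri>)
open import Data.Maybe using (Maybe; just; nothing; maybe′)
open import Data.Maybe.Properties using (just-injective)
open import Function.Bundles using (_⇔_; mk⇔; _↔_; Inverse; Equivalence)
open import Function.Properties.Inverse using (↔-refl; ↔-trans)
open import Data.Sum.Function.Propositional using (_⊎-↔_)
open import Data.Product.Function.NonDependent.Propositional using (_×-↔_)
open import Relation.Nullary.Decidable using (dec-true; dec-false; does-⇔; _⊎-dec_)
open import Relation.Binary.PropositionalEquality
  using (_≡_; refl; sym; trans; cong; cong₂; subst; subst₂; module ≡-Reasoning)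

mutual
  leafCount : ∀ {m} → Tree m → ℕ
  leafCount (leaf _)    = 1
  leafCount (node _ ts) = leafCountL ts

  leafCountL : ∀ {m} → List (Tree m) → ℕ
  leafCountL []       = 0
  leafCountL (t ∷ ts) = leafCount t + leafCountL ts

mutual
  pos : ∀ {m} {t : Tree m} → Leaf t → ℕ
  pos here      = 0
  pos (under p) = posL p

  posL : ∀ {m} {ts : List (Tree m)} → LeafL ts → ℕ
  posL (here p)            = pos p
  posL (there {t = t} p)   = leafCount t + posL p

mutual
  pos<leafCount : ∀ {m} {t : Tree m} (u : Leaf t) → pos u < leafCount t
  pos<leafCount here      = s≤s z≤n
  pos<leafCount (under p) = posL<leafCountL p

  posL<leafCountL : ∀ {m} {ts : List (Tree m)} (u : LeafL ts) → posL u < leafCountL ts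
  posL<leafCountL {ts = t ∷ ts} (here p)  =
    <-≤-trans (pos<leafCount p) (m≤m+n (leafCount t) (leafCountL ts))
  posL<leafCountL {ts = t ∷ ts} (there p) = +-monoʳ-< (leafCount t) (posL<leafCountL p)

first<later : ∀ {m} {t : Tree m} {ts : List (Tree m)} (p : Leaf t) (q : LeafL ts) →
  pos p < leafCount t + posL q
first<later {t = t} p q = <-≤-trans (pos<leafCount p) (m≤m+n (leafCount t) (posL q))

mutual
  pos-injective : ∀ {m} {t : Tree m} (u v : Leaf t) → pos u ≡ pos v → u ≡ v
  pos-injective here      here      _ = refl
  pos-injective (under p) (under q) e = cong under (posL-injective p q e)

  posL-injective : ∀ {m} {ts : List (Tree m)} (u v : LeafL ts) → posL u ≡ posL v → u ≡ v
  posL-injective (here p)  (here q)  e = cong here (pos-injective p q e)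
  posL-injective (here p)  (there q) e = ⊥-elim (<-irrefl e (first<later p q))
  posL-injective (there p) (here q)  e = ⊥-elim (<-irrefl (sym e) (first<later q p))
  posL-injective {ts = t ∷ _} (there p) (there q) e =
    cong there (posL-injective p q (+-cancelˡ-≡ (leafCount t) _ _ e))

mutual
  -- The (a,b)-twisted order: list the leaves left to right, but at every node v
  -- with f_v(a,b) = true list the children of v from right to left.
  twist : ∀ {m} {t : Tree m} (a b : Fin m) → Leaf t → ℕ
  twist a b here              = 0
  twist a b (under {f = f} p) = twistL f a b p

  twistL : ∀ {m} {ts : List (Tree m)} (f : Fin m → Fin m → Bool) (a b : Fin m) → LeafL ts → ℕ
  twistL f a b (here {ts = ts} p) = (if f a b then leafCountL ts else 0) + twist a b p
  twistL f a b (there {t = t} p)  = (if f a b then 0 else leafCount t) + twistL f a b p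

mutual
  twist<leafCount : ∀ {m} {t : Tree m} a b (u : Leaf t) → twist a b u < leafCount t
  twist<leafCount a b here      = s≤s z≤n
  twist<leafCount a b (under p) = twistL<leafCountL _ a b p

  twistL<leafCountL : ∀ {m} {ts : List (Tree m)} f a b (u : LeafL ts) → twistL f a b u < leafCountL ts
  twistL<leafCountL {ts = t ∷ ts} f a b (here p) with f a b
  ... | true  = subst (_< leafCount t + leafCountL ts) (+-comm (twist a b p) (leafCountL ts))
                  (+-monoˡ-< (leafCountL ts) (twist<leafCount a b p))
  ... | false = <-≤-trans (twist<leafCount a b p) (m≤m+n (leafCount t) (leafCountL ts))
  twistL<leafCountL {ts = t ∷ ts} f a b (there p) with f a b
  ... | true  = <-≤-trans (twistL<leafCountL f a b p) (m≤n+m (leafCountL ts) (leafCount t))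
  ... | false = +-monoʳ-< (leafCount t) (twistL<leafCountL f a b p)

<?-shift : ∀ c x y → does (c + x <? c + y) ≡ does (x <? y)
<?-shift c x y = does-⇔ (mk⇔ (+-cancelˡ-< c x y) (+-monoʳ-< c)) (c + x <? c + y) (x <? y)

-- A leaf x of the first child (x < s = its size) and a leaf y of a later
-- child (y < S = size of the later children): the twisted order puts y
-- before x exactly when the children are reversed.
children-reversed : ∀ (r : Bool) {x y s S} → x < s → y < S →
  r ≡ does ((if r then 0 else s) + y <? (if r then S else 0) + x)
children-reversed true  {x}     x<s y<S =
  sym (dec-true (_ <? _) (<-≤-trans y<S (m≤m+n _ x)))
children-reversed false {y = y} x<s y<S =
  sym (dec-false (_ <? _) (≤⇒≯ (≤-trans (<⇒≤ x<s) (m≤m+n _ y))))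

mutual
  -- Key lemma: in an embedded m-partite cograph, a leaf u left of a leaf v is
  -- adjacent to v iff the (γ u, γ v)-twisted order puts v before u; so the
  -- adjacency between two colour classes is read off from two linear orders.
  adjacency-is-inversion : ∀ {m} (t : Tree m) (u v : Leaf t) → pos u < pos v →
    cgAdj t u v ≡ does (twist (colour u) (colour v) v <? twist (colour u) (colour v) u)
  adjacency-is-inversion (leaf _)    here      here      ()
  adjacency-is-inversion (node f ts) (under p) (under q) u<v = adjacency-is-inversionL f ts p q u<v

  adjacency-is-inversionL : ∀ {m} f (ts : List (Tree m)) (u v : LeafL ts) → posL u < posL v →
    cgAdjL f ts u v ≡ does (twistL f (colourL u) (colourL v) v <? twistL f (colourL u) (colourL v) u)
  adjacency-is-inversionL f (t ∷ ts) (here p) (here q) u<v =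
    trans (adjacency-is-inversion t p q u<v)
          (sym (<?-shift (if f (colour p) (colour q) then leafCountL ts else 0) _ _))
  adjacency-is-inversionL f (t ∷ ts) (here p) (there q) _ =
    children-reversed (f (colour p) (colourL q))
      (twist<leafCount (colour p) (colourL q) p) (twistL<leafCountL f (colour p) (colourL q) q)
  adjacency-is-inversionL f (t ∷ ts) (there p) (here q) u<v = ⊥-elim (<-asym u<v (first<later q p))
  adjacency-is-inversionL f (t ∷ ts) (there p) (there q) u<v =
    trans (adjacency-is-inversionL f ts p q (+-cancelˡ-< (leafCount t) _ _ u<v))
          (sym (<?-shift (if f (colourL p) (colourL q) then 0 else leafCount t) _ _))

toℚ : ℕ → ℚ
toℚ n = mkℚ (ℤ.+ n) 0 (Coprime.sym (Coprime.1-coprimeTo n))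

toℚ-mono-< : ∀ {p q} → p < q → toℚ p ℚ.< toℚ q
toℚ-mono-< {p} {q} p<q =
  ℚ.*<* (subst₂ ℤ._<_ (sym (ℤ.*-identityʳ (ℤ.+ p))) (sym (ℤ.*-identityʳ (ℤ.+ q)))
                      (ℤ.+<+ p<q))

toℚ-cancel-< : ∀ {p q} → toℚ p ℚ.< toℚ q → p < q
toℚ-cancel-< {p} {q} (ℚ.*<* p<q) =
  ℤ.drop‿+<+ (subst₂ ℤ._<_ (ℤ.*-identityʳ (ℤ.+ p)) (ℤ.*-identityʳ (ℤ.+ q)) p<q)

toℚ-injective : ∀ {p q} → toℚ p ≡ toℚ q → p ≡ q
toℚ-injective e = ℤ.+-injective (cong ℚ.ℚ.numerator e)

module _ {n : ℕ} {ρ : Vec ℚ n} {i j : Fin n} {p q : ℕ}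
         (ρi : lookup ρ i ≡ toℚ p) (ρj : lookup ρ j ≡ toℚ q) where

  sat-≐ : Sat (i ≐ j) ρ ⇔ (p ≡ q)
  sat-≐ = mk⇔ (λ e → toℚ-injective (trans (sym ρi) (trans e ρj)))
              (λ p≡q → trans ρi (trans (cong toℚ p≡q) (sym ρj)))

  sat-≺ : Sat (i ≺ j) ρ ⇔ (p < q)
  sat-≺ = mk⇔ (λ s → toℚ-cancel-< (subst₂ ℚ._<_ ρi ρj s))
              (λ p<q → subst₂ ℚ._<_ (sym ρi) (sym ρj) (toℚ-mono-< p<q))

⋁ : ∀ {n} N → (Fin N → Formula n) → Formula n
⋁ zero    g = ⊥'
⋁ (suc N) g = g zero ∨' ⋁ N (g ∘ suc)

⋁-elim : ∀ {n} N (g : Fin N → Formula n) ρ → Sat (⋁ N g) ρ → Σ (Fin N) λ c → Sat (g c) ρ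
⋁-elim (suc N) g ρ (inj₁ s) = zero , s
⋁-elim (suc N) g ρ (inj₂ s) with ⋁-elim N (g ∘ suc) ρ s
... | c , s′ = suc c , s′

⋁-intro : ∀ {n} N (g : Fin N → Formula n) ρ c → Sat (g c) ρ → Sat (⋁ N g) ρ
⋁-intro (suc N) g ρ zero    s = inj₁ s
⋁-intro (suc N) g ρ (suc c) s = inj₂ (⋁-intro N (g ∘ suc) ρ c s)

-- Coordinates of a vertex with respect to n charts and m colours: its index,
-- the constant 1, and for every chart σ and colours a, b the indicator that its
-- leaf has colour a, its position, and its (a,b)-twisted position.
Coord : ℕ → ℕ → Set
Coord n m = ⊤ ⊎ ⊤ ⊎ (Fin n × Fin m) ⊎ Fin n ⊎ (Fin n × Fin m × Fin m)

pattern index             = inj₁ tt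
pattern one               = inj₂ (inj₁ tt)
pattern colourIs σ a      = inj₂ (inj₂ (inj₁ (σ , a)))
pattern posIn σ           = inj₂ (inj₂ (inj₂ (inj₁ σ)))
pattern twistIn σ a b     = inj₂ (inj₂ (inj₂ (inj₂ (σ , a , b))))

coordCount : ℕ → ℕ → ℕ
coordCount n m = 1 + (1 + (n * m + (n + n * (m * m))))

coordCode : ∀ n m → Fin (coordCount n m) ↔ Coord n m
coordCode n m =
  ↔-trans +↔⊎ (1↔⊤ ⊎-↔ ↔-trans +↔⊎ (1↔⊤ ⊎-↔ ↔-trans +↔⊎ (*↔× ⊎-↔ ↔-trans +↔⊎
    (↔-refl ⊎-↔ ↔-trans *↔× (↔-refl ×-↔ *↔×)))))

module Coordinates {C : Set} {k : ℕ} (code : Fin k ↔ C) where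
  open Inverse code using (to; from; strictlyInverseˡ)

  tuple : (C → ℕ) → Vec ℚ k
  tuple val = tabulate (toℚ ∘ val ∘ to)

  X Y : C → Fin (k + k)
  X c = from c ↑ˡ k
  Y c = k ↑ʳ from c

  lookup-tuple : ∀ val c → lookup (tuple val) (from c) ≡ toℚ (val c)
  lookup-tuple val c = trans (lookup∘tabulate _ (from c)) (cong (toℚ ∘ val) (strictlyInverseˡ c))

  tuple-injective : ∀ {val val′} c → tuple val ≡ tuple val′ → val c ≡ val′ c
  tuple-injective {val} {val′} c e = toℚ-injective
    (trans (sym (lookup-tuple val c)) (trans (cong (λ v → lookup v (from c)) e) (lookup-tuple val′ c)))

  lookup-X : ∀ val val′ c → lookup (tuple val ++ tuple val′) (X c) ≡ toℚ (val c)
  lookup-X val val′ c = trans (lookup-++ˡ (tuple val) (tuple val′) (from c)) (lookup-tuple val c)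

  lookup-Y : ∀ val val′ c → lookup (tuple val ++ tuple val′) (Y c) ≡ toℚ (val′ c)
  lookup-Y val val′ c = trans (lookup-++ʳ (tuple val) (tuple val′) (from c)) (lookup-tuple val′ c)

record Chart (m : ℕ) (G : FinGraph) : Set where
  field
    tree             : Tree m
    leafOf           : Fin (size G) → Maybe (Leaf tree)
    leafOf-adj       : ∀ {x y u v} → leafOf x ≡ just u → leafOf y ≡ just v →
                       adj G x y ≡ cgAdj tree u v
    leafOf-injective : ∀ {x y u} → leafOf x ≡ just u → leafOf y ≡ just u → x ≡ y

  Charted : Fin (size G) → Set
  Charted x = Σ (Leaf tree) λ u → leafOf x ≡ just u

open Chart

ChartCover : ℕ → ℕ → FinGraph → Set
ChartCover m n G = Σ (Fin n → Chart m G) λ chart →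
  ∀ x y → Σ (Fin n) λ σ → Charted (chart σ) x × Charted (chart σ) y

indicator : ∀ {P : Set} → Dec P → ℕ
indicator (yes _) = 1
indicator (no _)  = 0

indicator≡1 : ∀ {P : Set} (d : Dec P) → indicator d ≡ 1 → P
indicator≡1 (yes p) _ = p

indicator-yes : ∀ {P : Set} (d : Dec P) → P → indicator d ≡ 1
indicator-yes (yes _) _ = refl
indicator-yes (no ¬p) p = ⊥-elim (¬p p)

does-true : ∀ {P : Set} (d : Dec P) → does d ≡ true → P
does-true (yes p) _ = p

module ChartFormula (n m : ℕ) where
  open Coordinates (coordCode n m) public

  adjacentIn : Fin n → Fin m → Fin m → Formula (coordCount n m + coordCount n m)
  adjacentIn σ a b =
    (X (colourIs σ a) ≐ X one) ∧' ((Y (colourIs σ b) ≐ Y one) ∧'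
    ((X (posIn σ) ≺ Y (posIn σ)) ∧' (Y (twistIn σ a b) ≺ X (twistIn σ a b))))

  chartFormula : Formula (coordCount n m + coordCount n m)
  chartFormula = ⋁ n λ σ → ⋁ m λ a → ⋁ m λ b → adjacentIn σ a b

  chartFormula-elim : ∀ ρ → Sat chartFormula ρ →
    Σ (Fin n) λ σ → Σ (Fin m) λ a → Σ (Fin m) λ b → Sat (adjacentIn σ a b) ρ
  chartFormula-elim ρ s with ⋁-elim n _ ρ s
  ... | σ , s₁ with ⋁-elim m _ ρ s₁
  ... | a , s₂ with ⋁-elim m _ ρ s₂
  ... | b , s₃ = σ , a , b , s₃

  chartFormula-intro : ∀ ρ σ a b → Sat (adjacentIn σ a b) ρ → Sat chartFormula ρ
  chartFormula-intro ρ σ a b s =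
    ⋁-intro n _ ρ σ (⋁-intro m _ ρ a (⋁-intro m (adjacentIn σ a) ρ b s))

module ChartEmbedding {m n : ℕ} (G : FinGraph) (cover : ChartCover m n G) where
  open ChartFormula n m
  open ≡-Reasoning

  chart : Fin n → Chart m G
  chart = proj₁ cover

  atLeaf : ∀ σ → (Leaf (tree (chart σ)) → ℕ) → Fin (size G) → ℕ
  atLeaf σ f x = maybe′ f 0 (leafOf (chart σ) x)

  coords : Fin (size G) → Coord n m → ℕ
  coords x index          = toℕ x
  coords x one            = 1
  coords x (colourIs σ a)  = atLeaf σ (λ u → indicator (colour u ≟ a)) x
  coords x (posIn σ)       = atLeaf σ pos x
  coords x (twistIn σ a b) = atLeaf σ (twist a b) x

  point : Fin (size G) → Vec ℚ (coordCount n m)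
  point x = tuple (coords x)

  -- the index coordinate makes the points distinct
  point-injective : ∀ x y → point x ≡ point y → x ≡ y
  point-injective x y e = toℕ-injective (tuple-injective {coords x} {coords y} index e)

  atLeaf-just : ∀ {σ x u} f → leafOf (chart σ) x ≡ just u → atLeaf σ f x ≡ f u
  atLeaf-just f e = cong (maybe′ f 0) e

  colourIs≡1 : ∀ σ a x → coords x (colourIs σ a) ≡ 1 →
    Σ (Leaf (tree (chart σ))) λ u → leafOf (chart σ) x ≡ just u × colour u ≡ a
  colourIs≡1 σ a x e with leafOf (chart σ) x
  ... | just u = u , refl , indicator≡1 (colour u ≟ a) e

  module _ (x y : Fin (size G)) where
    ρ : Vec ℚ (coordCount n m + coordCount n m)
    ρ = point x ++ point y

    lookX : ∀ c → lookup ρ (X c) ≡ toℚ (coords x c)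
    lookX = lookup-X (coords x) (coords y)

    lookY : ∀ c → lookup ρ (Y c) ≡ toℚ (coords y c)
    lookY = lookup-Y (coords x) (coords y)

    sat-X≐X : ∀ c d → Sat (X c ≐ X d) ρ ⇔ (coords x c ≡ coords x d)
    sat-X≐X c d = sat-≐ {ρ = ρ} {i = X c} {j = X d} (lookX c) (lookX d)

    sat-Y≐Y : ∀ c d → Sat (Y c ≐ Y d) ρ ⇔ (coords y c ≡ coords y d)
    sat-Y≐Y c d = sat-≐ {ρ = ρ} {i = Y c} {j = Y d} (lookY c) (lookY d)

    sat-X≺Y : ∀ c d → Sat (X c ≺ Y d) ρ ⇔ (coords x c < coords y d)
    sat-X≺Y c d = sat-≺ {ρ = ρ} {i = X c} {j = Y d} (lookX c) (lookY d)

    sat-Y≺X : ∀ c d → Sat (Y c ≺ X d) ρ ⇔ (coords y c < coords x d)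
    sat-Y≺X c d = sat-≺ {ρ = ρ} {i = Y c} {j = X d} (lookY c) (lookX d)

  adjacentIn-sound : ∀ {σ a b} x y → Sat (adjacentIn σ a b) (ρ x y) → adj G x y ≡ true
  adjacentIn-sound {σ} {a} {b} x y (x∶a , y∶b , x≺y , y≺x)
    with colourIs≡1 σ a x (Equivalence.to (sat-X≐X x y (colourIs σ a) one) x∶a)
       | colourIs≡1 σ b y (Equivalence.to (sat-Y≐Y x y (colourIs σ b) one) y∶b)
  ... | u , xu , refl | v , yv , refl = begin
    adj G x y                         ≡⟨ leafOf-adj (chart σ) xu yv ⟩
    cgAdj (tree (chart σ)) u v        ≡⟨ adjacency-is-inversion _ u v u<v ⟩
    does (twist a b v <? twist a b u) ≡⟨ dec-true (_ <? _) v<u ⟩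
    true                              ∎
    where
    u<v : pos u < pos v
    u<v = subst₂ _<_ (atLeaf-just pos xu) (atLeaf-just pos yv)
                 (Equivalence.to (sat-X≺Y x y (posIn σ) (posIn σ)) x≺y)
    v<u : twist a b v < twist a b u
    v<u = subst₂ _<_ (atLeaf-just (twist a b) yv) (atLeaf-just (twist a b) xu)
                 (Equivalence.to (sat-Y≺X x y (twistIn σ a b) (twistIn σ a b)) y≺x)

  adjacentIn-complete : ∀ {σ u v} x y →
    leafOf (chart σ) x ≡ just u → leafOf (chart σ) y ≡ just v →
    pos u < pos v → adj G x y ≡ true → Sat (adjacentIn σ (colour u) (colour v)) (ρ x y)
  adjacentIn-complete {σ} {u} {v} x y xu yv u<v xy =
    Equivalence.from (sat-X≐X x y (colourIs σ (colour u)) one)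
      (trans (atLeaf-just _ xu) (indicator-yes (colour u ≟ colour u) refl)) ,
    Equivalence.from (sat-Y≐Y x y (colourIs σ (colour v)) one)
      (trans (atLeaf-just _ yv) (indicator-yes (colour v ≟ colour v) refl)) ,
    Equivalence.from (sat-X≺Y x y (posIn σ) (posIn σ))
      (subst₂ _<_ (sym (atLeaf-just pos xu)) (sym (atLeaf-just pos yv)) u<v) ,
    Equivalence.from (sat-Y≺X x y (twistIn σ (colour u) (colour v)) (twistIn σ (colour u) (colour v)))
      (subst₂ _<_ (sym (atLeaf-just (twist _ _) yv)) (sym (atLeaf-just (twist _ _) xu)) v<u)
    where
    v<u : twist (colour u) (colour v) v < twist (colour u) (colour v) u
    v<u = does-true (_ <? _) (trans (sym (adjacency-is-inversion _ u v u<v))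
                                    (trans (sym (leafOf-adj (chart σ) xu yv)) xy))

  -- completeness: distinct adjacent vertices satisfy φ in one of the two orders,
  -- namely in a chart containing both, in the order of their leaves
  complete : ∀ x y → ¬ x ≡ y → adj G x y ≡ true →
    UAdj (coordCount n m) chartFormula (point x) (point y)
  complete x y x≢y xy with proj₂ cover x y
  ... | σ , (u , xu) , (v , yv) with <-cmp (pos u) (pos v)
  ... | tri< u<v _ _ = inj₁ (chartFormula-intro _ σ _ _ (adjacentIn-complete x y xu yv u<v xy))
  ... | tri≈ _ u≡v _ = ⊥-elim (x≢y (leafOf-injective (chart σ) xu yu))
    where
    yu : leafOf (chart σ) y ≡ just u
    yu = trans yv (cong just (sym (pos-injective u v u≡v)))
  ... | tri> _ _ v<u = inj₂ (chartFormula-intro _ σ _ _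
                              (adjacentIn-complete y x yv xu v<u (trans (FinGraph.sym G y x) xy)))

  sound : ∀ x y → Sat chartFormula (ρ x y) → adj G x y ≡ true
  sound x y s with chartFormula-elim _ s
  ... | _ , _ , _ , s′ = adjacentIn-sound x y s′

  inAge : InAge chartFormula G
  inAge = point , point-injective , λ x y x≢y →
    complete x y x≢y ,
    λ { (inj₁ s) → sound x y s ; (inj₂ s) → trans (FinGraph.sym G x y) (sound y x s) }

module _ {H : FinGraph} {V : Set} {a : V → V → Bool} (I : Iso H V a) where
  open Iso I

  iso-adj⁻¹ : ∀ v w → a v w ≡ adj H (from v) (from w)
  iso-adj⁻¹ v w = trans (cong₂ a (sym (to-from v)) (sym (to-from w))) (sym (pres (from v) (from w)))

  iso-from-injective : ∀ {v w} → from v ≡ from w → v ≡ w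
  iso-from-injective {v} {w} e = trans (sym (to-from v)) (trans (cong to e) (to-from w))

  iso-to-injective : ∀ {x y} → to x ≡ to y → x ≡ y
  iso-to-injective {x} {y} e = trans (sym (from-to x)) (trans (cong from e) (from-to y))

emptyChart : ∀ {m} G → Chart m G
emptyChart G = record
  { tree             = node (λ _ _ → false) []
  ; leafOf           = λ _ → nothing
  ; leafOf-adj       = λ ()
  ; leafOf-injective = λ ()
  }

OneOf : ∀ {K} → Fin K → Fin K → Fin K → Set
OneOf s t i = i ≡ s ⊎ i ≡ t

module PairChart {m K : ℕ} (G : FinGraph) (part : Fin (size G) → Fin K) (s t : Fin K)
                 {H : FinGraph} (isoG : Iso H (InPair G part s t) (pairAdj G part s t))
                 (T : Tree m) (isoT : Iso H (Leaf T) (cgAdj T)) where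
  open ≡-Reasoning

  leafOfPair : InPair G part s t → Leaf T
  leafOfPair = Iso.to isoT ∘ Iso.from isoG

  leafOfVertex : Fin (size G) → Maybe (Leaf T)
  leafOfVertex x with (part x ≟ s) ⊎-dec (part x ≟ t)
  ... | yes w = just (leafOfPair (x , w))
  ... | no _  = nothing

  leafOfVertex-just : ∀ {x u} → leafOfVertex x ≡ just u →
    Σ (OneOf s t (part x)) λ w → leafOfPair (x , w) ≡ u
  leafOfVertex-just {x} e with (part x ≟ s) ⊎-dec (part x ≟ t)
  leafOfVertex-just {x} e  | yes w = w , just-injective e
  leafOfVertex-just {x} () | no _

  leafOfPair-adj : ∀ p q → adj G (proj₁ p) (proj₁ q) ≡ cgAdj T (leafOfPair p) (leafOfPair q)
  leafOfPair-adj p q = begin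
    pairAdj G part s t p q                            ≡⟨ iso-adj⁻¹ isoG p q ⟩
    adj H (Iso.from isoG p) (Iso.from isoG q)         ≡⟨ Iso.pres isoT _ _ ⟩
    cgAdj T (leafOfPair p) (leafOfPair q)             ∎

  leafOfPair-injective : ∀ {p q} → leafOfPair p ≡ leafOfPair q → p ≡ q
  leafOfPair-injective = iso-from-injective isoG ∘ iso-to-injective isoT

  leafOfVertex-adj : ∀ {x y u v} → leafOfVertex x ≡ just u → leafOfVertex y ≡ just v →
    adj G x y ≡ cgAdj T u v
  leafOfVertex-adj ex ey with leafOfVertex-just ex | leafOfVertex-just ey
  ... | w , refl | w′ , refl = leafOfPair-adj (_ , w) (_ , w′)

  leafOfVertex-injective : ∀ {x y u} → leafOfVertex x ≡ just u → leafOfVertex y ≡ just u → x ≡ y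
  leafOfVertex-injective ex ey with leafOfVertex-just ex | leafOfVertex-just ey
  ... | w , refl | w′ , e = cong proj₁ (leafOfPair-injective (sym e))

  chart : Chart m G
  chart = record
    { tree             = T
    ; leafOf           = leafOfVertex
    ; leafOf-adj       = leafOfVertex-adj
    ; leafOf-injective = leafOfVertex-injective
    }

  covers : ∀ x → OneOf s t (part x) → Σ (Leaf T) λ u → leafOfVertex x ≡ just u
  covers x w with (part x ≟ s) ⊎-dec (part x ≟ t)
  ... | yes w′ = leafOfPair (x , w′) , refl
  ... | no ¬w  = ⊥-elim (¬w w)

pairContaining : ∀ {K} (i : Fin (suc (suc K))) →
  Σ (Fin (suc (suc K))) λ s → Σ (Fin (suc (suc K))) λ t → s F.< t × OneOf s t i
pairContaining zero    = zero , suc zero , z<s , inj₁ refl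
pairContaining (suc i) = zero , suc i    , z<s , inj₂ refl

pairContaining₂ : ∀ {K} → 2 ≤ K → (i j : Fin K) →
  Σ (Fin K) λ s → Σ (Fin K) λ t → s F.< t × OneOf s t i × OneOf s t j
pairContaining₂ (s≤s (s≤s z≤n)) i j with Fₚ.<-cmp i j
... | tri< i<j _ _ = i , j , i<j , inj₁ refl , inj₂ refl
... | tri> _ _ j<i = j , i , j<i , inj₂ refl , inj₁ refl
... | tri≈ _ refl _ with pairContaining i
...   | s , t , s<t , i∈st = s , t , s<t , i∈st , i∈st

-- A 2-covering of G by embedded m-partite cographs yields K² charts covering G:
-- one on V_s ∪ V_t for every s < t, and empty ones for the other pairs.
module TwoCoverCharts {m K : ℕ} {D : Class} (cographs : ∀ H → D H → IsEmbCograph m H)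
       (G : FinGraph) (part : Fin (size G) → Fin K)
       (pieces : ∀ s t → s F.< t →
                 Σ FinGraph λ H → D H × Iso H (InPair G part s t) (pairAdj G part s t))
       where

  pairChart : ∀ {s t} → s F.< t → Chart m G
  pairChart {s} {t} s<t with pieces s t s<t
  ... | H , H∈D , isoG with cographs H H∈D
  ...   | T , isoT = PairChart.chart G part s t isoG T isoT

  pairChart-covers : ∀ {s t} (s<t : s F.< t) x → OneOf s t (part x) →
    Charted (pairChart s<t) x
  pairChart-covers {s} {t} s<t x w with pieces s t s<t
  ... | H , H∈D , isoG with cographs H H∈D
  ...   | T , isoT = PairChart.covers G part s t isoG T isoT x w

  chartOn : Fin K → Fin K → Chart m G
  chartOn s t with s F.<? t
  ... | yes s<t = pairChart s<t
  ... | no _    = emptyChart G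

  chartOn-covers : ∀ {s t} → s F.< t → ∀ x → OneOf s t (part x) → Charted (chartOn s t) x
  chartOn-covers {s} {t} s<t x w with s F.<? t
  ... | yes s<t′ = pairChart-covers s<t′ x w
  ... | no s≮t   = ⊥-elim (s≮t s<t)

  charts : Fin (K * K) → Chart m G
  charts σ = uncurry chartOn (Inverse.to *↔× σ)

  charts-at : ∀ s t → charts (Inverse.from *↔× (s , t)) ≡ chartOn s t
  charts-at s t = cong (uncurry chartOn) (Inverse.strictlyInverseˡ *↔× (s , t))

  chartCover : 2 ≤ K → ChartCover m (K * K) G
  chartCover 2≤K = charts , cover
    where
    cover : ∀ x y → Σ (Fin (K * K)) λ σ → Charted (charts σ) x × Charted (charts σ) y
    cover x y with pairContaining₂ 2≤K (part x) (part y)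
    ... | s , t , s<t , x∈st , y∈st =
      Inverse.from *↔× (s , t) ,
      inChart (chartOn-covers s<t x x∈st) , inChart (chartOn-covers s<t y y∈st)
      where
      inChart : ∀ {z} → Charted (chartOn s t) z → Charted (charts (Inverse.from *↔× (s , t))) z
      inChart {z} = subst (λ c → Charted c z) (sym (charts-at s t))

mainTheorem3 : (m : ℕ) → 1 ≤ m → (C D : Class) →
    (∀ H → D H → IsEmbCograph m H) → TwoCovered C D → OrderDefined C
mainTheorem3 m _ C D cographs (K , 2≤K , covered) =
  coordCount (K * K) m , ChartFormula.chartFormula (K * K) m , inAge
  where
  inAge : ∀ G → C G → InAge (ChartFormula.chartFormula (K * K) m) G
  inAge G G∈C with covered G G∈C
  ... | part , pieces =
    ChartEmbedding.inAge G (TwoCoverCharts.chartCover cographs G part pieces 2≤K)
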